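{- For all constraint symbols $\lambda,\rho\in\{.,/,\backslash\}$ and all integers $m,n\ge 1$ for which the quantities involved are defined: (a) $.M\rho(m,n)\ge \lambda M\rho(m,n)$; (b) $/M\rho(m,n)\le .M\rho(m,n-1)+1$.
   Context: Knuth's restricted-adversary functions $\lambda M\rho(m,n)$, for constraint symbols $\lambda,\rho\in\{.,/,\backslash\}$ and integers $m,n\ge 0$, are defined as follows. Consider sorted lists $a_1<\cdots<a_m$ and $b_1<\cdots<b_n$ (all elements distinct, interleaving unknown). The left constraint $\lambda$ means: "." no information, "$\backslash$" it is known that $a_1<b_1$, "/" it is known that $a_1>b_1$. The right constraint $\rho$ means: "." no information, "$\backslash$" it is known that $a_m<b_n$, "/" it is known that $a_m>b_n$. A constraint attached to a problem one of whose lists is empty is vacuous. $\lambda M\rho(m,n)$ is defined when some interleaving satisfies the constraints. Its value is $0$ if the constraints determine the interleaving completely (in particular whenever $m=0$ or $n=0$). Otherwise $\lambda M\rho(m,n)=\min_{1\le i\le m,\,1\le j\le n}\lambda M_{i,j}\rho(m,n)$, where $\lambda M_{i,j}\rho(m,n)=1+\max$ over admissible splittings (for the comparison of $a_i$ with $b_j$) of the sum of the values of the two resulting subproblems. The splittings are: (S) simple: $0\le p\le m$, $0\le q\le n$; subproblem 1 is $(a_1,\dots,a_p;b_1,\dots,b_q)$, subproblem 2 is $(a_{p+1},\dots,a_m;b_{q+1},\dots,b_n)$, meaning every element of subproblem 1 is smaller than every element of subproblem 2; the values are $\lambda M.(p,q)$ and $.M\rho(m-p,n-q)$. (A) with $a_k$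 shared: $1\le k\le m$, $1\le q\le n-1$, meaning $b_q<a_k<b_{q+1}$; subproblem 1 is $(a_1,\dots,a_k;b_1,\dots,b_q)$ with value $\lambda M/(k,q)$ and subproblem 2 is $(a_k,\dots,a_m;b_{q+1},\dots,b_n)$ with value $\backslash M\rho(m-k+1,n-q)$. (B) with $b_l$ shared: $1\le p\le m-1$, $1\le l\le n$, meaning $a_p<b_l<a_{p+1}$; subproblem 1 is $(a_1,\dots,a_p;b_1,\dots,b_l)$ with value $\lambda M\backslash(p,l)$ and subproblem 2 is $(a_{p+1},\dots,a_m;b_l,\dots,b_n)$ with value $/M\rho(m-p,n-l+1)$. A splitting is admissible for the comparison $a_i$ versus $b_j$ if $a_i$ and $b_j$ lie in different subproblems (so neither is the shared element) and some interleaving satisfies both the relations imposed by the splitting and the constraints $\lambda,\rho$. -}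

module Defs where

open import Data.Bool using (Bool; true; false; _∧_; _∨_; not; _xor_; if_then_else_)
open import Data.Nat using (ℕ; zero; suc; _+_; _∸_; _⊔_; _⊓_; _≤ᵇ_; _<ᵇ_; _≡ᵇ_)
open import Data.List using (List; []; _∷_; [_]; map; _++_; foldr; upTo; concatMap; take)

-- Constraint symbols: dot = ".", sl = "/", bs = "\"
data Con : Set where
  dot sl bs : Con

-- An interleaving of a_1<..<a_m and b_1<..<b_n is the sequence of list
-- labels in increasing order: true = an element of a, false = of b.
interleavings : ℕ → ℕ → List (List Bool)
interleavings zero zero = [ [] ]
interleavings zero (suc n) = map (false ∷_) (interleavings zero n)
interleavings (suc m) zero = map (true ∷_) (interleavings m zero)
interleavings (suc m) (suc n) =
  map (true ∷_) (interleavings m (suc n)) ++ map (false ∷_) (interleavings (suc m) n)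

headB : List Bool → Bool
headB [] = false
headB (x ∷ _) = x

lastB : List Bool → Bool
lastB [] = false
lastB (x ∷ []) = x
lastB (_ ∷ y ∷ ys) = lastB (y ∷ ys)

nonEmpty : ℕ → ℕ → Bool
nonEmpty m n = not (m ≡ᵇ 0) ∧ not (n ≡ᵇ 0)

-- left constraint: "\" means a_1 < b_1 (interleaving starts with a),
-- "/" means a_1 > b_1; vacuous if a list is empty
leftOK : Con → ℕ → ℕ → List Bool → Bool
leftOK dot m n w = true
leftOK bs m n w = not (nonEmpty m n) ∨ headB w
leftOK sl m n w = not (nonEmpty m n) ∨ not (headB w)

-- right constraint: "\" means a_m < b_n (interleaving ends with b),
-- "/" means a_m > b_n
rightOK : Con → ℕ → ℕ → List Bool → Bool
rightOK dot m n w = true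
rightOK bs m n w = not (nonEmpty m n) ∨ not (lastB w)
rightOK sl m n w = not (nonEmpty m n) ∨ lastB w

sat : Con → Con → ℕ → ℕ → List Bool → Bool
sat l r m n w = leftOK l m n w ∧ rightOK r m n w

countB : (List Bool → Bool) → List (List Bool) → ℕ
countB P [] = 0
countB P (w ∷ ws) = if P w then suc (countB P ws) else countB P ws

anyB : (List Bool → Bool) → List (List Bool) → Bool
anyB P [] = false
anyB P (w ∷ ws) = P w ∨ anyB P ws

satCount : Con → Con → ℕ → ℕ → ℕ
satCount l r m n = countB (λ w → sat l r m n w) (interleavings m n)

Defined : Con → Con → ℕ → ℕ → Set
Defined l r m n = 1 Data.Nat.≤ satCount l r m n

countT : List Bool → ℕ
countT [] = 0
countT (true ∷ xs) = suc (countT xs)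
countT (false ∷ xs) = countT xs

-- oppBefore x k w: number of elements of the other list preceding the
-- (k+1)-th occurrence of label x in w
oppBefore : Bool → ℕ → List Bool → ℕ
oppBefore x k [] = 0
oppBefore true k (true ∷ ys) with k
... | zero = 0
... | suc k' = oppBefore true k' ys
oppBefore false k (false ∷ ys) with k
... | zero = 0
... | suc k' = oppBefore false k' ys
oppBefore true k (false ∷ ys) = suc (oppBefore true k ys)
oppBefore false k (true ∷ ys) = suc (oppBefore false k ys)

-- splitting relations
-- (S) (p,q): a_1..a_p,b_1..b_q all precede the rest
simpleRel : ℕ → ℕ → List Bool → Bool
simpleRel p q w = countT (take (p + q) w) ≡ᵇ p
-- (A) b_q < a_k < b_{q+1}: exactly q b's precede a_k
aRel : ℕ → ℕ → List Bool → Bool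
aRel k q w = oppBefore true (k ∸ 1) w ≡ᵇ q
-- (B) a_p < b_l < a_{p+1}: exactly p a's precede b_l
bRel : ℕ → ℕ → List Bool → Bool
bRel p l w = oppBefore false (l ∸ 1) w ≡ᵇ p

consistent : Con → Con → ℕ → ℕ → (List Bool → Bool) → Bool
consistent l r m n rel = anyB (λ w → sat l r m n w ∧ rel w) (interleavings m n)

from0 : ℕ → List ℕ
from0 k = upTo (suc k)
from1 : ℕ → List ℕ
from1 k = map suc (upTo k)

maxList : List ℕ → ℕ
maxList = foldr _⊔_ 0

minList : List ℕ → ℕ
minList [] = 0
minList (x ∷ xs) = foldr _⊓_ x xs

admS : Con → Con → ℕ → ℕ → ℕ → ℕ → ℕ → ℕ → Bool
admS l r m n i j p q = ((i ≤ᵇ p) xor (j ≤ᵇ q)) ∧ consistent l r m n (simpleRel p q)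

admA : Con → Con → ℕ → ℕ → ℕ → ℕ → ℕ → ℕ → Bool
admA l r m n i j k q =
  not (i ≡ᵇ k) ∧ ((i <ᵇ k) xor (j ≤ᵇ q)) ∧ consistent l r m n (aRel k q)

admB : Con → Con → ℕ → ℕ → ℕ → ℕ → ℕ → ℕ → Bool
admB l r m n i j p l' =
  not (j ≡ᵇ l') ∧ ((i ≤ᵇ p) xor (j <ᵇ l')) ∧ consistent l r m n (bRel p l')

-- fuel-bounded evaluation; fuel suc (m+n) suffices since each
-- subproblem of an admissible splitting has fewer elements in total
Mf : ℕ → Con → Con → ℕ → ℕ → ℕ
Mf zero l r m n = 0
Mf (suc f) l r m n =
  if satCount l r m n ≤ᵇ 1 then 0
  else minList (concatMap (λ i → map (λ j → suc (maxList (vals i j))) (from1 n)) (from1 m))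
  where
  valsS : ℕ → ℕ → List ℕ
  valsS i j = concatMap (λ p → concatMap (λ q →
      if admS l r m n i j p q then [ Mf f l dot p q + Mf f dot r (m ∸ p) (n ∸ q) ] else [])
      (from0 n)) (from0 m)
  valsA : ℕ → ℕ → List ℕ
  valsA i j = concatMap (λ k → concatMap (λ q →
      if admA l r m n i j k q then [ Mf f l sl k q + Mf f bs r (suc (m ∸ k)) (n ∸ q) ] else [])
      (from1 (n ∸ 1))) (from1 m)
  valsB : ℕ → ℕ → List ℕ
  valsB i j = concatMap (λ p → concatMap (λ l' →
      if admB l r m n i j p l' then [ Mf f l bs p l' + Mf f sl r (m ∸ p) (suc (n ∸ l')) ] else [])
      (from1 n)) (from1 (m ∸ 1))
  vals : ℕ → ℕ → List ℕ
  vals i j = valsS i j ++ valsA i j ++ valsB i j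

-- Knuth's  λ M ρ (m,n)   (meaningful when Defined λ ρ m n)
M : Con → Con → ℕ → ℕ → ℕ
M l r m n = Mf (suc (m + n)) l r m n

-- M is a minimum over comparisons of a maximum over admissible splittings, so M P ≤ c + M Q
-- follows once every comparison of Q is answered by a comparison of P each of whose admissible
-- splittings is matched by an admissible splitting of Q worth at least its value minus c.
-- (a) A left constraint only removes interleavings, so the same comparison and splittings serve,
-- and the first subproblems, which inherit the left constraint, are handled by induction.
-- (b) In /Mρ(m,n) the element b₁ is the smallest one. Answer the comparison of a_i with b_j in
-- .Mρ(m,n-1) on b₂,…,b_n by comparing a_i with b_{j+1}. Deleting b₁ maps each admissible splitting
-- to one of the smaller problem; only the first part changes, by losing b₁, and by induction that
-- saves at most one comparison. The exception is b₁ < a₁ < … < a_k < b₂ with a_k shared, which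
-- becomes the simple splitting after a_{k-1}; there /M/(k,1) ≤ 1.
-- M is evaluated with fuel m+n+1; any fuel ≥ m+n gives the same value, since admissible
-- splittings have strictly smaller subproblems.

module Submission where

open import Defs
open import Data.Bool using (Bool; true; false; T; not; _∧_; _xor_; if_then_else_)
open import Data.Bool.Properties using (T-∧; T-∨; T-≡; ∧-assoc)
open import Data.Empty using (⊥-elim)
open import Data.List using (List; []; _∷_; map; _++_; concatMap; take; length)
open import Data.List.Properties using (length-map; foldr-preservesᵇ; foldr-preservesᵒ)
open import Data.List.Membership.Propositional using (_∈_; find; lose)
open import Data.List.Membership.Propositional.Properties
  using (∈-map⁺; ∈-map⁻; ∈-++⁺ˡ; ∈-++⁺ʳ; ∈-++⁻; ∈-upTo⁺; ∈-upTo⁻; ∈-concatMap⁺; ∈-concatMap⁻; foldr-selective)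
import Data.List.Relation.Unary.All as All
import Data.List.Relation.Unary.Any as Any
open import Data.List.Relation.Unary.Any using (Any; here; there)
open import Data.Nat using (ℕ; zero; suc; _+_; _∸_; _≤_; _<_; _≤ᵇ_; _<ᵇ_; _≡ᵇ_; _≤?_; z≤n; s≤s)
open import Data.Nat.Properties
open import Data.Product using (_×_; _,_; proj₁; proj₂; ∃; ∃₂)
open import Data.Sum using (_⊎_; inj₁; inj₂; [_,_]; [_,_]′)
open import Function using (_∘_; id; Equivalence)
open import Relation.Binary.PropositionalEquality using (_≡_; refl; sym; trans; cong; cong₂; subst; module ≡-Reasoning)
open import Relation.Nullary using (¬_; yes; no)

open Equivalence using (to; from)

from0-bound : ∀ {i k} → i ∈ from0 k → i ≤ k
from0-bound i∈ = ≤-pred (∈-upTo⁻ i∈)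

∈-from0 : ∀ {i k} → i ≤ k → i ∈ from0 k
∈-from0 i≤k = ∈-upTo⁺ (s≤s i≤k)

from1-bounds : ∀ {i k} → i ∈ from1 k → 1 ≤ i × i ≤ k
from1-bounds i∈ with ∈-map⁻ suc i∈
... | _ , i′∈ , refl = s≤s z≤n , ∈-upTo⁻ i′∈

∈-from1 : ∀ {i k} → 1 ≤ i → i ≤ k → i ∈ from1 k
∈-from1 {suc i} _ i≤k = ∈-map⁺ suc (∈-upTo⁺ i≤k)

from1-pred-bounds : ∀ {i k} → i ∈ from1 (k ∸ 1) → 1 ≤ i × i < k
from1-pred-bounds {k = zero} ()
from1-pred-bounds {k = suc k} i∈ with from1-bounds i∈
... | 1≤i , i≤k = 1≤i , s≤s i≤k

∈-from1-pred : ∀ {i k} → 1 ≤ i → i < k → i ∈ from1 (k ∸ 1)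
∈-from1-pred 1≤i (s≤s i≤k) = ∈-from1 1≤i i≤k

minList-≤ : ∀ {x} xs → x ∈ xs → minList xs ≤ x
minList-≤ {x} (y ∷ ys) x∈ = foldr-preservesᵒ {P = _≤ x} (λ a b → [ m≤n⇒m⊓o≤n b , m≤n⇒o⊓m≤n a ]) y ys (bound x∈)
  where
  bound : x ∈ y ∷ ys → y ≤ x ⊎ Any (_≤ x) ys
  bound (here refl)  = inj₁ ≤-refl
  bound (there x∈ys) = inj₂ (Any.map (≤-reflexive ∘ sym) x∈ys)

minList-∈ : ∀ {x xs} → x ∈ xs → minList xs ∈ xs
minList-∈ {xs = y ∷ ys} _ with foldr-selective ⊓-sel y ys
... | inj₁ min≡y  = here min≡y
... | inj₂ min∈ys = there min∈ys

≤-maxList : ∀ {x} xs → x ∈ xs → x ≤ maxList xs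
≤-maxList {x} xs x∈ = foldr-preservesᵒ {P = x ≤_} (λ a b → [ m≤n⇒m≤n⊔o b , m≤n⇒m≤o⊔n a ]) 0 xs (inj₂ (Any.map ≤-reflexive x∈))

maxList-≤ : ∀ {b} xs → (∀ {x} → x ∈ xs → x ≤ b) → maxList xs ≤ b
maxList-≤ {b} xs bound = foldr-preservesᵇ {P = _≤ b} ⊔-lub z≤n (All.tabulate bound)

table : (ℕ → ℕ → Bool) → (ℕ → ℕ → ℕ) → List ℕ → List ℕ → List ℕ
table C V P Q = concatMap (λ p → concatMap (λ q → if C p q then V p q ∷ [] else []) Q) P

module _ (C : ℕ → ℕ → Bool) (V : ℕ → ℕ → ℕ) (P Q : List ℕ) where
  private
    entry : ℕ → ℕ → List ℕ
    entry p q = if C p q then V p q ∷ [] else []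
    row : ℕ → List ℕ
    row p = concatMap (entry p) Q

  ∈-table⁻ : ∀ {y} → y ∈ table C V P Q → ∃₂ λ p q → p ∈ P × q ∈ Q × T (C p q) × y ≡ V p q
  ∈-table⁻ y∈ =
    let p , p∈ , y∈row   = find (∈-concatMap⁻ row y∈)
        q , q∈ , y∈entry = find (∈-concatMap⁻ (entry p) y∈row)
        c , y≡           = guard⁻ (C p q) y∈entry
    in p , q , p∈ , q∈ , c , y≡
    where
    guard⁻ : ∀ b {v y} → y ∈ (if b then v ∷ [] else []) → T b × y ≡ v
    guard⁻ true (here refl) = _ , refl

  ∈-table⁺ : ∀ {p q} → p ∈ P → q ∈ Q → T (C p q) → V p q ∈ table C V P Q
  ∈-table⁺ {p} {q} p∈ q∈ c =
    ∈-concatMap⁺ row (lose p∈ (∈-concatMap⁺ (entry p) (lose q∈ (guard⁺ (C p q) c))))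
    where
    guard⁺ : ∀ b {v} → T b → v ∈ (if b then v ∷ [] else [])
    guard⁺ true _ = here refl

grid : (ℕ → ℕ → ℕ) → ℕ → ℕ → List ℕ
grid F m n = concatMap (λ i → map (F i) (from1 n)) (from1 m)

∈-grid⁻ : ∀ F m n {x} → x ∈ grid F m n → ∃₂ λ i j → (1 ≤ i × i ≤ m) × (1 ≤ j × j ≤ n) × x ≡ F i j
∈-grid⁻ F m n x∈ =
  let i , i∈ , x∈row = find (∈-concatMap⁻ (λ i → map (F i) (from1 n)) x∈)
      j , j∈ , x≡    = ∈-map⁻ (F i) x∈row
  in i , j , from1-bounds i∈ , from1-bounds j∈ , x≡

∈-grid⁺ : ∀ F m n {i j} → 1 ≤ i → i ≤ m → 1 ≤ j → j ≤ n → F i j ∈ grid F m n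
∈-grid⁺ F m n {i} 1≤i i≤m 1≤j j≤n =
  ∈-concatMap⁺ (λ i → map (F i) (from1 n))
    (lose (∈-from1 1≤i i≤m) (∈-map⁺ (F i) (∈-from1 1≤j j≤n)))

minList-grid-≤ : ∀ c F G m n m′ n′ → 1 ≤ m′ → 1 ≤ n′ →
  (∀ {i′ j′} → 1 ≤ i′ → i′ ≤ m′ → 1 ≤ j′ → j′ ≤ n′ →
     ∃₂ λ i j → (1 ≤ i × i ≤ m) × (1 ≤ j × j ≤ n) × F i j ≤ c + G i′ j′) →
  minList (grid F m n) ≤ c + minList (grid G m′ n′)
minList-grid-≤ c F G m n m′ n′ 1≤m′ 1≤n′ sim
  with ∈-grid⁻ G m′ n′ (minList-∈ (∈-grid⁺ G m′ n′ ≤-refl 1≤m′ ≤-refl 1≤n′))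
... | i′ , j′ , (1≤i′ , i′≤m′) , (1≤j′ , j′≤n′) , min≡ with sim 1≤i′ i′≤m′ 1≤j′ j′≤n′
... | i , j , (1≤i , i≤m) , (1≤j , j≤n) , F≤G = begin
  minList (grid F m n)          ≤⟨ minList-≤ (grid F m n) (∈-grid⁺ F m n 1≤i i≤m 1≤j j≤n) ⟩
  F i j                         ≤⟨ F≤G ⟩
  c + G i′ j′                   ≡⟨ cong (c +_) min≡ ⟨
  c + minList (grid G m′ n′)    ∎
  where open ≤-Reasoning

_≼⟨_⟩_ : List ℕ → ℕ → List ℕ → Set
xs ≼⟨ c ⟩ ys = ∀ {x} → x ∈ xs → ∃ λ y → y ∈ ys × x ≤ c + y

maxList-mono-≼ : ∀ c xs ys → xs ≼⟨ c ⟩ ys → maxList xs ≤ c + maxList ys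
maxList-mono-≼ c xs ys xs≼ys = maxList-≤ xs λ x∈ →
  let y , y∈ , x≤ = xs≼ys x∈ in ≤-trans x≤ (+-monoʳ-≤ c (≤-maxList ys y∈))

countB-≤-length : ∀ P ws → countB P ws ≤ length ws
countB-≤-length P []       = z≤n
countB-≤-length P (w ∷ ws) with P w
... | true  = s≤s (countB-≤-length P ws)
... | false = m≤n⇒m≤1+n (countB-≤-length P ws)

countB-mono : ∀ P Q ws → (∀ {w} → w ∈ ws → T (P w) → T (Q w)) → countB P ws ≤ countB Q ws
countB-mono P Q []       P⇒Q = z≤n
countB-mono P Q (w ∷ ws) P⇒Q with P w in Pw | Q w in Qw
... | true  | true  = s≤s (countB-mono P Q ws (P⇒Q ∘ there))
... | true  | false = ⊥-elim (subst T Qw (P⇒Q (here refl) (subst T (sym Pw) _)))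
... | false | true  = m≤n⇒m≤1+n (countB-mono P Q ws (P⇒Q ∘ there))
... | false | false = countB-mono P Q ws (P⇒Q ∘ there)

countB-++ : ∀ P xs ys → countB P (xs ++ ys) ≡ countB P xs + countB P ys
countB-++ P []       ys = refl
countB-++ P (x ∷ xs) ys with P x
... | true  = cong suc (countB-++ P xs ys)
... | false = countB-++ P xs ys

countB-map : ∀ P g xs → countB P (map g xs) ≡ countB (P ∘ g) xs
countB-map P g []       = refl
countB-map P g (x ∷ xs) with P (g x)
... | true  = cong suc (countB-map P g xs)
... | false = countB-map P g xs

countB-none : ∀ P xs → (∀ w → P w ≡ false) → countB P xs ≡ 0
countB-none P []       none = refl
countB-none P (x ∷ xs) none rewrite none x = countB-none P xs none

countB-interleavings : ∀ P m n →
  countB P (interleavings (suc m) (suc n))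
    ≡ countB (P ∘ (true ∷_)) (interleavings m (suc n)) + countB (P ∘ (false ∷_)) (interleavings (suc m) n)
countB-interleavings P m n = begin
  countB P (map (true ∷_) A ++ map (false ∷_) B)
    ≡⟨ countB-++ P (map (true ∷_) A) (map (false ∷_) B) ⟩
  countB P (map (true ∷_) A) + countB P (map (false ∷_) B)
    ≡⟨ cong₂ _+_ (countB-map P (true ∷_) A) (countB-map P (false ∷_) B) ⟩
  countB (P ∘ (true ∷_)) A + countB (P ∘ (false ∷_)) B ∎
  where
  open ≡-Reasoning
  A = interleavings m (suc n)
  B = interleavings (suc m) n

length-interleavings-0ʳ : ∀ m → length (interleavings m 0) ≡ 1
length-interleavings-0ʳ zero    = refl
length-interleavings-0ʳ (suc m) = trans (length-map (true ∷_) (interleavings m 0)) (length-interleavings-0ʳ m)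

length-interleavings-0ˡ : ∀ n → length (interleavings 0 n) ≡ 1
length-interleavings-0ˡ zero    = refl
length-interleavings-0ˡ (suc n) = trans (length-map (false ∷_) (interleavings 0 n)) (length-interleavings-0ˡ n)

countT-interleavings : ∀ m n {w} → w ∈ interleavings m n → countT w ≡ m
countT-interleavings zero    zero    (here refl) = refl
countT-interleavings zero    (suc n) w∈ with ∈-map⁻ (false ∷_) w∈
... | _ , v∈ , refl = countT-interleavings zero n v∈
countT-interleavings (suc m) zero    w∈ with ∈-map⁻ (true ∷_) w∈
... | _ , v∈ , refl = cong suc (countT-interleavings m zero v∈)
countT-interleavings (suc m) (suc n) w∈ with ∈-++⁻ (map (true ∷_) (interleavings m (suc n))) w∈
... | inj₁ w∈A with ∈-map⁻ (true ∷_) w∈A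
...   | _ , v∈ , refl = cong suc (countT-interleavings m (suc n) v∈)
countT-interleavings (suc m) (suc n) w∈ | inj₂ w∈B with ∈-map⁻ (false ∷_) w∈B
...   | _ , v∈ , refl = countT-interleavings (suc m) n v∈

anyB⁻ : ∀ P ws → T (anyB P ws) → ∃ λ w → w ∈ ws × T (P w)
anyB⁻ P (w ∷ ws) any with to T-∨ any
... | inj₁ Pw   = w , here refl , Pw
... | inj₂ rest = let v , v∈ , Pv = anyB⁻ P ws rest in v , there v∈ , Pv

anyB⁺ : ∀ P ws {w} → w ∈ ws → T (P w) → T (anyB P ws)
anyB⁺ P (w ∷ ws) (here refl) Pw = from T-∨ (inj₁ Pw)
anyB⁺ P (v ∷ ws) (there w∈) Pw  = from T-∨ (inj₂ (anyB⁺ P ws w∈ Pw))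

satCount-0ʳ : ∀ l r m → satCount l r m 0 ≤ 1
satCount-0ʳ l r m = ≤-trans (countB-≤-length _ (interleavings m 0)) (≤-reflexive (length-interleavings-0ʳ m))

satCount-0ˡ : ∀ l r n → satCount l r 0 n ≤ 1
satCount-0ˡ l r n = ≤-trans (countB-≤-length _ (interleavings 0 n)) (≤-reflexive (length-interleavings-0ˡ n))

satCount>1⇒nonempty : ∀ l r m n → ¬ satCount l r m n ≤ 1 → 1 ≤ m × 1 ≤ n
satCount>1⇒nonempty l r zero    n       large = ⊥-elim (large (satCount-0ˡ l r n))
satCount>1⇒nonempty l r (suc m) zero    large = ⊥-elim (large (satCount-0ʳ l r (suc m)))
satCount>1⇒nonempty l r (suc m) (suc n) large = s≤s z≤n , s≤s z≤n

data Splitting : Set where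
  simple  : (p q : ℕ) → Splitting
  sharedA : (k q : ℕ) → Splitting
  sharedB : (p l : ℕ) → Splitting

InRange : ℕ → ℕ → Splitting → Set
InRange m n (simple p q)  = p ≤ m × q ≤ n
InRange m n (sharedA k q) = (1 ≤ k × k ≤ m) × (1 ≤ q × q < n)
InRange m n (sharedB p l) = (1 ≤ p × p < m) × (1 ≤ l × l ≤ n)

separates : ℕ → ℕ → Splitting → Bool
separates i j (simple p q)  = (i ≤ᵇ p) xor (j ≤ᵇ q)
separates i j (sharedA k q) = not (i ≡ᵇ k) ∧ ((i <ᵇ k) xor (j ≤ᵇ q))
separates i j (sharedB p l) = not (j ≡ᵇ l) ∧ ((i ≤ᵇ p) xor (j <ᵇ l))

relation : Splitting → List Bool → Bool
relation (simple p q)  = simpleRel p q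
relation (sharedA k q) = aRel k q
relation (sharedB p l) = bRel p l

record Admissible (l r : Con) (m n i j : ℕ) (s : Splitting) : Set where
  constructor admissible
  field
    inRange    : InRange m n s
    separated  : T (separates i j s)
    satisfiable : T (consistent l r m n (relation s))

value : ℕ → Con → Con → ℕ → ℕ → Splitting → ℕ
value f l r m n (simple p q)   = Mf f l dot p q + Mf f dot r (m ∸ p) (n ∸ q)
value f l r m n (sharedA k q)  = Mf f l sl k q + Mf f bs r (suc (m ∸ k)) (n ∸ q)
value f l r m n (sharedB p l′) = Mf f l bs p l′ + Mf f sl r (m ∸ p) (suc (n ∸ l′))

-- vals and cell are the where-block of Mf restated through value, so that Mf (suc f) unfolds
-- definitionally to the minimum of a grid of cells.
vals : ℕ → Con → Con → ℕ → ℕ → ℕ → ℕ → List ℕ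
vals f l r m n i j =
  table (admS l r m n i j) (λ p q → value f l r m n (simple p q)) (from0 m) (from0 n) ++
  table (admA l r m n i j) (λ k q → value f l r m n (sharedA k q)) (from1 m) (from1 (n ∸ 1)) ++
  table (admB l r m n i j) (λ p l′ → value f l r m n (sharedB p l′)) (from1 (m ∸ 1)) (from1 n)

cell : ℕ → Con → Con → ℕ → ℕ → ℕ → ℕ → ℕ
cell f l r m n i j = suc (maxList (vals f l r m n i j))

module _ (f : ℕ) (l r : Con) (m n i j : ℕ) where
  private
    CS = admS l r m n i j
    VS = λ p q → value f l r m n (simple p q)
    CA = admA l r m n i j
    VA = λ k q → value f l r m n (sharedA k q)
    CB = admB l r m n i j
    VB = λ p l′ → value f l r m n (sharedB p l′)
    tableS = table CS VS (from0 m) (from0 n)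
    tableA = table CA VA (from1 m) (from1 (n ∸ 1))
    tableB = table CB VB (from1 (m ∸ 1)) (from1 n)

  ∈-vals⁻ : ∀ {x} → x ∈ vals f l r m n i j → ∃ λ s → Admissible l r m n i j s × x ≡ value f l r m n s
  ∈-vals⁻ {x} x∈ = [ fromS , [ fromA , fromB ]′ ∘ ∈-++⁻ tableA ]′ (∈-++⁻ tableS x∈)
    where
    Goal = ∃ λ s → Admissible l r m n i j s × x ≡ value f l r m n s

    fromS : x ∈ tableS → Goal
    fromS x∈S =
      let p , q , p∈ , q∈ , adm , x≡ = ∈-table⁻ CS VS (from0 m) (from0 n) x∈S
          sep , sat = to T-∧ adm
      in simple p q , admissible (from0-bound p∈ , from0-bound q∈) sep sat , x≡

    fromA : x ∈ tableA → Goal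
    fromA x∈A =
      let k , q , k∈ , q∈ , adm , x≡ = ∈-table⁻ CA VA (from1 m) (from1 (n ∸ 1)) x∈A
          sep , sat = to T-∧ (subst T (sym (∧-assoc (not (i ≡ᵇ k)) _ _)) adm)
      in sharedA k q , admissible (from1-bounds k∈ , from1-pred-bounds q∈) sep sat , x≡

    fromB : x ∈ tableB → Goal
    fromB x∈B =
      let p , l′ , p∈ , l′∈ , adm , x≡ = ∈-table⁻ CB VB (from1 (m ∸ 1)) (from1 n) x∈B
          sep , sat = to T-∧ (subst T (sym (∧-assoc (not (j ≡ᵇ l′)) _ _)) adm)
      in sharedB p l′ , admissible (from1-pred-bounds p∈ , from1-bounds l′∈) sep sat , x≡

  ∈-vals⁺ : ∀ {s} → Admissible l r m n i j s → value f l r m n s ∈ vals f l r m n i j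
  ∈-vals⁺ {simple p q} (admissible (p≤m , q≤n) sep sat) =
    ∈-++⁺ˡ (∈-table⁺ CS VS (from0 m) (from0 n) (∈-from0 p≤m) (∈-from0 q≤n) (from T-∧ (sep , sat)))
  ∈-vals⁺ {sharedA k q} (admissible ((1≤k , k≤m) , (1≤q , q<n)) sep sat) =
    ∈-++⁺ʳ tableS (∈-++⁺ˡ (∈-table⁺ CA VA (from1 m) (from1 (n ∸ 1))
      (∈-from1 1≤k k≤m) (∈-from1-pred 1≤q q<n) (subst T (∧-assoc (not (i ≡ᵇ k)) _ _) (from T-∧ (sep , sat)))))
  ∈-vals⁺ {sharedB p l′} (admissible ((1≤p , p<m) , (1≤l′ , l′≤n)) sep sat) =
    ∈-++⁺ʳ tableS (∈-++⁺ʳ tableA (∈-table⁺ CB VB (from1 (m ∸ 1)) (from1 n)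
      (∈-from1-pred 1≤p p<m) (∈-from1 1≤l′ l′≤n) (subst T (∧-assoc (not (j ≡ᵇ l′)) _ _) (from T-∧ (sep , sat)))))

if-≤ᵇ-yes : ∀ {x y} {A : Set} {a b : A} → x ≤ y → (if x ≤ᵇ y then a else b) ≡ a
if-≤ᵇ-yes x≤y rewrite to T-≡ (≤⇒≤ᵇ x≤y) = refl

if-≤ᵇ-no : ∀ {x y} {A : Set} {a b : A} → ¬ x ≤ y → (if x ≤ᵇ y then a else b) ≡ b
if-≤ᵇ-no {x} {y} x≰y with x ≤ᵇ y in x≤ᵇy
... | true  = ⊥-elim (x≰y (≤ᵇ⇒≤ x y (from T-≡ x≤ᵇy)))
... | false = refl

Mf-small : ∀ f l r m n → satCount l r m n ≤ 1 → Mf f l r m n ≡ 0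
Mf-small zero    l r m n small = refl
Mf-small (suc f) l r m n small = if-≤ᵇ-yes small

Mf-0ʳ : ∀ f l r m → Mf f l r m 0 ≡ 0
Mf-0ʳ f l r m = Mf-small f l r m 0 (satCount-0ʳ l r m)

Mf-suc-≤ : ∀ c f l r m n f′ l′ r′ m′ n′ →
  (satCount l′ r′ m′ n′ ≤ 1 → satCount l r m n ≤ 1) →
  (∀ {i′ j′} → 1 ≤ i′ → i′ ≤ m′ → 1 ≤ j′ → j′ ≤ n′ →
     ∃₂ λ i j → (1 ≤ i × i ≤ m) × (1 ≤ j × j ≤ n) ×
       ∀ {s} → Admissible l r m n i j s →
         ∃ λ s′ → Admissible l′ r′ m′ n′ i′ j′ s′ × value f l r m n s ≤ c + value f′ l′ r′ m′ n′ s′) →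
  Mf (suc f) l r m n ≤ c + Mf (suc f′) l′ r′ m′ n′
Mf-suc-≤ c f l r m n f′ l′ r′ m′ n′ small⇒small sim with satCount l r m n ≤? 1
... | yes small = ≤-trans (≤-reflexive (if-≤ᵇ-yes small)) z≤n
... | no large  = begin
  Mf (suc f) l r m n                   ≡⟨ if-≤ᵇ-no large ⟩
  minList (grid (cell f l r m n) m n)  ≤⟨ minList-grid-≤ c _ _ m n m′ n′ 1≤m′ 1≤n′ cell-sim ⟩
  c + minList (grid (cell f′ l′ r′ m′ n′) m′ n′) ≡⟨ cong (c +_) (if-≤ᵇ-no large′) ⟨
  c + Mf (suc f′) l′ r′ m′ n′          ∎
  where
  open ≤-Reasoning
  large′ : ¬ satCount l′ r′ m′ n′ ≤ 1
  large′ = large ∘ small⇒small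
  1≤m′ = proj₁ (satCount>1⇒nonempty l′ r′ m′ n′ large′)
  1≤n′ = proj₂ (satCount>1⇒nonempty l′ r′ m′ n′ large′)
  cell-sim : ∀ {i′ j′} → 1 ≤ i′ → i′ ≤ m′ → 1 ≤ j′ → j′ ≤ n′ →
     ∃₂ λ i j → (1 ≤ i × i ≤ m) × (1 ≤ j × j ≤ n) × cell f l r m n i j ≤ c + cell f′ l′ r′ m′ n′ i′ j′
  cell-sim {i′} {j′} 1≤i′ i′≤m′ 1≤j′ j′≤n′ =
    let i , j , i-range , j-range , splits = sim 1≤i′ i′≤m′ 1≤j′ j′≤n′
        dominated : vals f l r m n i j ≼⟨ c ⟩ vals f′ l′ r′ m′ n′ i′ j′
        dominated x∈ =
          let s , adm , x≡ = ∈-vals⁻ f l r m n i j x∈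
              s′ , adm′ , v≤ = splits adm
          in value f′ l′ r′ m′ n′ s′ , ∈-vals⁺ f′ l′ r′ m′ n′ i′ j′ adm′ , subst (_≤ c + value f′ l′ r′ m′ n′ s′) (sym x≡) v≤
    in i , j , i-range , j-range ,
       ≤-trans (s≤s (maxList-mono-≼ c _ _ dominated)) (≤-reflexive (sym (+-suc c _)))

sat⇒sat-dot : ∀ l r m n w → T (sat l r m n w) → T (sat dot r m n w)
sat⇒sat-dot l r m n w = proj₂ ∘ to T-∧

satCount-≤-dot : ∀ l r m n → satCount l r m n ≤ satCount dot r m n
satCount-≤-dot l r m n = countB-mono _ _ (interleavings m n) λ {w} _ → sat⇒sat-dot l r m n w

consistent⇒consistent-dot : ∀ l r m n rel → T (consistent l r m n rel) → T (consistent dot r m n rel)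
consistent⇒consistent-dot l r m n rel cons =
  let w , w∈ , sat∧rel = anyB⁻ _ (interleavings m n) cons
      satw , relw = to T-∧ sat∧rel
  in anyB⁺ _ (interleavings m n) w∈ (from T-∧ (sat⇒sat-dot l r m n w satw , relw))

Mf-left-≤-dot : ∀ f l r m n → Mf f l r m n ≤ Mf f dot r m n
Mf-left-≤-dot zero    l r m n = z≤n
Mf-left-≤-dot (suc f) l r m n =
  Mf-suc-≤ 0 f l r m n f dot r m n (≤-trans (satCount-≤-dot l r m n))
    λ {i} {j} 1≤i i≤m 1≤j j≤n → i , j , (1≤i , i≤m) , (1≤j , j≤n) , λ {s} adm → s , relax adm , value-≤ s
  where
  relax : ∀ {i j s} → Admissible l r m n i j s → Admissible dot r m n i j s
  relax {s = s} (admissible range sep sat) =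
    admissible range sep (consistent⇒consistent-dot l r m n (relation s) sat)
  value-≤ : ∀ s → value f l r m n s ≤ value f dot r m n s
  value-≤ (simple p q)   = +-monoˡ-≤ _ (Mf-left-≤-dot f l dot p q)
  value-≤ (sharedA k q)  = +-monoˡ-≤ _ (Mf-left-≤-dot f l sl k q)
  value-≤ (sharedB p l′) = +-monoˡ-≤ _ (Mf-left-≤-dot f l bs p l′)

m∸n<m : ∀ {m n} → 1 ≤ n → n ≤ m → m ∸ n < m
m∸n<m = ∸-monoʳ-< {o = 0}

value-fuel-≤ : ∀ f f′ l r m n {i j} s → 1 ≤ i → i ≤ m → 1 ≤ j → j ≤ n → InRange m n s → T (separates i j s) →
  (∀ l r m′ n′ → m′ + n′ < m + n → Mf f l r m′ n′ ≤ Mf f′ l r m′ n′) →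
  value f l r m n s ≤ value f′ l r m n s
value-fuel-≤ f f′ l r m n {i} {j} (simple p q) 1≤i i≤m 1≤j j≤n (p≤m , q≤n) sep smaller
  with i ≤ᵇ p in i≤ᵇp | j ≤ᵇ q in j≤ᵇq
... | true  | false = +-mono-≤ (smaller l dot p q (+-mono-≤-< p≤m q<n))
                               (smaller dot r (m ∸ p) (n ∸ q) (+-mono-<-≤ (m∸n<m 1≤p p≤m) (m∸n≤m n q)))
  where
  1≤p = ≤-trans 1≤i (≤ᵇ⇒≤ i p (from T-≡ i≤ᵇp))
  q<n = <-≤-trans (≰⇒> (λ j≤q → subst T j≤ᵇq (≤⇒≤ᵇ j≤q))) j≤n
... | false | true  = +-mono-≤ (smaller l dot p q (+-mono-<-≤ p<m q≤n))
                               (smaller dot r (m ∸ p) (n ∸ q) (+-mono-≤-< (m∸n≤m m p) (m∸n<m 1≤q q≤n)))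
  where
  1≤q = ≤-trans 1≤j (≤ᵇ⇒≤ j q (from T-≡ j≤ᵇq))
  p<m = <-≤-trans (≰⇒> (λ i≤p → subst T i≤ᵇp (≤⇒≤ᵇ i≤p))) i≤m
value-fuel-≤ f f′ l r m n (sharedA k q) _ _ _ _ ((1≤k , k≤m) , (1≤q , q<n)) _ smaller =
  +-mono-≤ (smaller l sl k q (+-mono-≤-< k≤m q<n))
           (smaller bs r (suc (m ∸ k)) (n ∸ q) (+-mono-≤-< (m∸n<m 1≤k k≤m) (m∸n<m 1≤q (<⇒≤ q<n))))
value-fuel-≤ f f′ l r m n (sharedB p l′) _ _ _ _ ((1≤p , p<m) , (1≤l′ , l′≤n)) _ smaller =
  +-mono-≤ (smaller l bs p l′ (+-mono-<-≤ p<m l′≤n))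
           (smaller sl r (m ∸ p) (suc (n ∸ l′)) (+-mono-<-≤ (m∸n<m 1≤p (<⇒≤ p<m)) (m∸n<m 1≤l′ l′≤n)))

Mf-fuel-≤ : ∀ f f′ l r m n → m + n ≤ f → m + n ≤ f′ → Mf f l r m n ≤ Mf f′ l r m n
Mf-fuel-≤ zero    f′       l r m       n       _     _ = z≤n
Mf-fuel-≤ (suc f) zero     l r zero    zero    _     _ = ≤-reflexive (Mf-0ʳ (suc f) l r 0)
Mf-fuel-≤ (suc f) zero     l r zero    (suc n) _     ()
Mf-fuel-≤ (suc f) zero     l r (suc m) n       _     ()
Mf-fuel-≤ (suc f) (suc f′) l r m       n       m+n≤ m+n≤′ =
  Mf-suc-≤ 0 f l r m n f′ l r m n id λ {i} {j} 1≤i i≤m 1≤j j≤n →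
    i , j , (1≤i , i≤m) , (1≤j , j≤n) , λ {s} adm →
      s , adm , value-fuel-≤ f f′ l r m n s 1≤i i≤m 1≤j j≤n (inRange adm) (separated adm) smaller
  where
  open Admissible
  smaller : ∀ l r m′ n′ → m′ + n′ < m + n → Mf f l r m′ n′ ≤ Mf f′ l r m′ n′
  smaller l r m′ n′ lt = Mf-fuel-≤ f f′ l r m′ n′ (≤-pred (≤-trans lt m+n≤)) (≤-pred (≤-trans lt m+n≤′))

rightOK-drop-b₁ : ∀ r m n {w} → w ∈ interleavings (suc m) n →
  T (rightOK r (suc m) (suc n) (false ∷ w)) → T (rightOK r (suc m) n w)
rightOK-drop-b₁ dot m n       _  _  = _
rightOK-drop-b₁ sl  m zero    _  _  = _
rightOK-drop-b₁ bs  m zero    _  _  = _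
rightOK-drop-b₁ sl  m (suc n) {[]}    w∈ _ with () ← countT-interleavings (suc m) (suc n) w∈
rightOK-drop-b₁ bs  m (suc n) {[]}    w∈ _ with () ← countT-interleavings (suc m) (suc n) w∈
rightOK-drop-b₁ sl  m (suc n) {_ ∷ _} _  ok = ok
rightOK-drop-b₁ bs  m (suc n) {_ ∷ _} _  ok = ok

satCount-sl-≤-dot : ∀ r m n → satCount sl r (suc m) (suc n) ≤ satCount dot r (suc m) n
satCount-sl-≤-dot r m n = begin
  countB P (interleavings (suc m) (suc n))
    ≡⟨ countB-interleavings P m n ⟩
  countB (P ∘ (true ∷_)) (interleavings m (suc n)) + countB (P ∘ (false ∷_)) B
    -- the constraint / rejects every interleaving that starts with an a
    ≡⟨ cong (_+ countB (P ∘ (false ∷_)) B) (countB-none (P ∘ (true ∷_)) (interleavings m (suc n)) (λ _ → refl)) ⟩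
  countB (P ∘ (false ∷_)) B
    ≤⟨ countB-mono _ _ B (rightOK-drop-b₁ r m n) ⟩
  countB (sat dot r (suc m) n) B ∎
  where
  open ≤-Reasoning
  P = sat sl r (suc m) (suc n)
  B = interleavings (suc m) n

satCount-sl-small : ∀ r m n → satCount dot r m n ≤ 1 → satCount sl r m (suc n) ≤ 1
satCount-sl-small r zero    n _     = satCount-0ˡ sl r (suc n)
satCount-sl-small r (suc m) n small = ≤-trans (satCount-sl-≤-dot r m n) small

consistent-sl-witness : ∀ r m n rel → T (consistent sl r (suc m) (suc n) rel) →
  ∃ λ w → w ∈ interleavings (suc m) n × T (rightOK r (suc m) n w) × T (rel (false ∷ w))
consistent-sl-witness r m n rel cons
  with anyB⁻ _ (interleavings (suc m) (suc n)) cons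
... | w , w∈ , ok with ∈-++⁻ (map (true ∷_) (interleavings m (suc n))) w∈
...   | inj₁ w∈A with ∈-map⁻ (true ∷_) w∈A
...     | _ , _ , refl = ⊥-elim ok
consistent-sl-witness r m n rel cons | w , w∈ , ok | inj₂ w∈B with ∈-map⁻ (false ∷_) w∈B
...     | v , v∈ , refl = let right , relv = to T-∧ ok in v , v∈ , rightOK-drop-b₁ r m n v∈ right , relv

consistent-drop-b₁ : ∀ r m n rel rel′ →
  (∀ {w} → w ∈ interleavings (suc m) n → T (rel (false ∷ w)) → T (rel′ w)) →
  T (consistent sl r (suc m) (suc n) rel) → T (consistent dot r (suc m) n rel′)
consistent-drop-b₁ r m n rel rel′ shift cons =
  let w , w∈ , right , relw = consistent-sl-witness r m n rel cons
  in anyB⁺ _ (interleavings (suc m) n) w∈ (from T-∧ (right , shift w∈ relw))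

countT-take-≤ : ∀ k w → countT (take k w) ≤ k
countT-take-≤ zero    w           = z≤n
countT-take-≤ (suc k) []          = z≤n
countT-take-≤ (suc k) (true ∷ w)  = s≤s (countT-take-≤ k w)
countT-take-≤ (suc k) (false ∷ w) = m≤n⇒m≤1+n (countT-take-≤ k w)

countT-take-oppBefore-0 : ∀ k w → oppBefore true k w ≡ 0 → k < countT w → countT (take k w) ≡ k
countT-take-oppBefore-0 zero    (true ∷ w) _   _         = refl
countT-take-oppBefore-0 (suc k) (true ∷ w) opp (s≤s k<) = cong suc (countT-take-oppBefore-0 k w opp k<)

¬simpleRel-b-first : ∀ p w → ¬ T (simpleRel (suc p) 0 (false ∷ w))
¬simpleRel-b-first p w prefix = 1+n≰n (begin
  suc p                   ≡⟨ ≡ᵇ⇒≡ _ _ prefix ⟨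
  countT (take (p + 0) w) ≤⟨ countT-take-≤ (p + 0) w ⟩
  p + 0                   ≡⟨ +-identityʳ p ⟩
  p                       ∎)
  where open ≤-Reasoning

aRel-b-first⇒simpleRel : ∀ m n k {w} → k ≤ m → w ∈ interleavings (suc m) n →
  T (aRel (suc k) 1 (false ∷ w)) → T (simpleRel k 0 w)
aRel-b-first⇒simpleRel m n k {w} k≤m w∈ opp≡0 = ≡⇒≡ᵇ (countT (take (k + 0) w)) k (begin
  countT (take (k + 0) w) ≡⟨ cong (λ t → countT (take t w)) (+-identityʳ k) ⟩
  countT (take k w)       ≡⟨ countT-take-oppBefore-0 k w (≡ᵇ⇒≡ _ 0 opp≡0) k<countT ⟩
  k                       ∎)
  where
  open ≡-Reasoning
  k<countT = subst (k <_) (sym (countT-interleavings (suc m) n w∈)) (s≤s k≤m)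

value-sharedA-b₁-≤ : ∀ f r m n k → k ≤ m → (∀ r m n → Mf f sl r m (suc n) ≤ suc (Mf f dot r m n)) →
  value f sl r (suc m) (suc (suc n)) (sharedA (suc k) 1) ≤ suc (value f dot r (suc m) (suc n) (simple k 0))
value-sharedA-b₁-≤ f r m n k k≤m IH = begin
  Mf f sl sl (suc k) 1 + Mf f bs r (suc (m ∸ k)) (suc n)
    ≤⟨ +-mono-≤ first≤1 (Mf-left-≤-dot f bs r (suc (m ∸ k)) (suc n)) ⟩
  1 + Mf f dot r (suc (m ∸ k)) (suc n)
    ≡⟨ cong (λ t → 1 + Mf f dot r t (suc n)) (+-∸-assoc 1 k≤m) ⟨
  1 + Mf f dot r (suc m ∸ k) (suc n)
    ≤⟨ s≤s (m≤n+m _ (Mf f dot dot k 0)) ⟩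
  suc (Mf f dot dot k 0 + Mf f dot r (suc m ∸ k) (suc n)) ∎
  where
  open ≤-Reasoning
  first≤1 : Mf f sl sl (suc k) 1 ≤ 1
  first≤1 = subst (λ t → Mf f sl sl (suc k) 1 ≤ suc t) (Mf-0ʳ f dot sl (suc k)) (IH sl (suc k) 0)

-- Lowering b-indices by one leaves the Boolean tests in separates unchanged definitionally,
-- so the separation proof sep carries over as it is.
splitting-drop-b₁ : ∀ f r m n i j {s} → (∀ r m n → Mf f sl r m (suc n) ≤ suc (Mf f dot r m n)) →
  Admissible sl r (suc m) (suc (suc n)) (suc i) (suc (suc j)) s →
  ∃ λ s′ → Admissible dot r (suc m) (suc n) (suc i) (suc j) s′ ×
           value f sl r (suc m) (suc (suc n)) s ≤ suc (value f dot r (suc m) (suc n) s′)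
splitting-drop-b₁ f r m n i j {simple zero zero} IH (admissible _ () _)
splitting-drop-b₁ f r m n i j {simple (suc p) zero} IH (admissible _ _ sat) =
  let w , _ , _ , prefix = consistent-sl-witness r m (suc n) _ sat in ⊥-elim (¬simpleRel-b-first p w prefix)
splitting-drop-b₁ f r m n i j {simple p (suc q)} IH (admissible (p≤ , q<) sep sat) =
  simple p q , admissible (p≤ , ≤-pred q<) sep (consistent-drop-b₁ r m (suc n) _ _ shift sat) ,
  +-monoˡ-≤ _ (IH dot p q)
  where
  shift : ∀ {w} → w ∈ interleavings (suc m) (suc n) → T (simpleRel p (suc q) (false ∷ w)) → T (simpleRel p q w)
  shift {w} _ = subst (λ t → T (countT (take t (false ∷ w)) ≡ᵇ p)) (+-suc p q)
splitting-drop-b₁ f r m n i j {sharedA zero q} IH (admissible ((() , _) , _) _ _)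
splitting-drop-b₁ f r m n i j {sharedA (suc k) zero} IH (admissible (_ , (() , _)) _ _)
splitting-drop-b₁ f r m n i j {sharedA (suc k) (suc zero)} IH (admissible ((_ , k<) , _) sep sat) =
  simple k 0 ,
  admissible (m≤n⇒m≤1+n (≤-pred k<) , z≤n) (proj₂ (to T-∧ sep))
             (consistent-drop-b₁ r m (suc n) _ _ (aRel-b-first⇒simpleRel m (suc n) k (≤-pred k<)) sat) ,
  value-sharedA-b₁-≤ f r m n k (≤-pred k<) IH
splitting-drop-b₁ f r m n i j {sharedA k (suc (suc q))} IH (admissible (k-range , (_ , q<)) sep sat) =
  sharedA k (suc q) , admissible (k-range , (s≤s z≤n , ≤-pred q<)) sep (consistent-drop-b₁ r m (suc n) _ _ (λ _ → id) sat) ,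
  +-monoˡ-≤ _ (IH sl k (suc q))
splitting-drop-b₁ f r m n i j {sharedB zero l} IH (admissible ((() , _) , _) _ _)
splitting-drop-b₁ f r m n i j {sharedB (suc p) zero} IH (admissible (_ , (() , _)) _ _)
splitting-drop-b₁ f r m n i j {sharedB (suc p) (suc zero)} IH (admissible _ _ sat)
  with consistent-sl-witness r m (suc n) _ sat
... | _ , _ , _ , ()
splitting-drop-b₁ f r m n i j {sharedB p (suc (suc l))} IH (admissible (p-range , (_ , l≤)) sep sat) =
  sharedB p (suc l) , admissible (p-range , (s≤s z≤n , ≤-pred l≤)) sep (consistent-drop-b₁ r m (suc n) _ _ (λ _ → id) sat) ,
  +-monoˡ-≤ _ (IH bs p (suc l))

Mf-sl-≤-suc-dot : ∀ f r m n → Mf f sl r m (suc n) ≤ suc (Mf f dot r m n)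
Mf-sl-≤-suc-dot zero    r m n = z≤n
Mf-sl-≤-suc-dot (suc f) r m n =
  Mf-suc-≤ 1 f sl r m (suc n) f dot r m n (satCount-sl-small r m n) (comparison m n)
  where
  comparison : ∀ m n {i j} → 1 ≤ i → i ≤ m → 1 ≤ j → j ≤ n →
    ∃₂ λ i′ j′ → (1 ≤ i′ × i′ ≤ m) × (1 ≤ j′ × j′ ≤ suc n) ×
      ∀ {s} → Admissible sl r m (suc n) i′ j′ s →
        ∃ λ s′ → Admissible dot r m n i j s′ × value f sl r m (suc n) s ≤ suc (value f dot r m n s′)
  comparison (suc m) (suc n) {suc i} {suc j} _ i≤m _ j≤n =
    suc i , suc (suc j) , (s≤s z≤n , i≤m) , (s≤s z≤n , s≤s j≤n) ,
    splitting-drop-b₁ f r m n i j (Mf-sl-≤-suc-dot f)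

lemma1 : ((l r : Con) (m n : ℕ) → 1 ≤ m → 1 ≤ n →
            Defined l r m n → Defined dot r m n →
            M l r m n ≤ M dot r m n)
         × ((r : Con) (m n : ℕ) → 1 ≤ m → 1 ≤ n →
            Defined sl r m n → Defined dot r m (n ∸ 1) →
            M sl r m n ≤ M dot r m (n ∸ 1) + 1)
lemma1 = (λ l r m n _ _ _ _ → Mf-left-≤-dot (suc (m + n)) l r m n) , part-b
  where
  part-b : (r : Con) (m n : ℕ) → 1 ≤ m → 1 ≤ n →
           Defined sl r m n → Defined dot r m (n ∸ 1) →
           M sl r m n ≤ M dot r m (n ∸ 1) + 1
  part-b r m (suc n) _ _ _ _ = begin
    M sl r m (suc n)                      ≤⟨ Mf-sl-≤-suc-dot (suc (m + suc n)) r m n ⟩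
    suc (Mf (suc (m + suc n)) dot r m n)  ≤⟨ s≤s (Mf-fuel-≤ _ _ dot r m n enough-fuel (n≤1+n (m + n))) ⟩
    suc (M dot r m n)                     ≡⟨ +-comm 1 (M dot r m n) ⟩
    M dot r m n + 1                       ∎
    where
    open ≤-Reasoning
    enough-fuel : m + n ≤ suc (m + suc n)
    enough-fuel = m≤n⇒m≤1+n (+-monoʳ-≤ m (n≤1+n n))
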